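{- Let $u\in V^2$ and set $U:=(V\setminus\{u_1\})\times(V\setminus\{u_2\})$. Let $f:V^2\to V$ be a binary injection which preserves $E$ and $N$, behaves like $p_1$ between all points $v,w\in U$, and behaves like $p_2$ between $u$ and every point of $U$. Then $f$ generates a binary injection of type $\min$ as well as a binary injection of type $\max$.
   Context: $G=(V;E)$ is the random (Rado) graph: the unique countably infinite homogeneous graph into which every finite graph embeds. $N(x,y)$ iff $x\neq y$ and $\neg E(x,y)$. $f$ preserves $E$ if $E(a_1,b_1)\wedge E(a_2,b_2)$ implies $E(f(a),f(b))$; likewise for $N$. $f$ behaves like $p_1$ between points $a,b\in V^2$ if, whenever $a_1\neq b_1$ and $a_2\neq b_2$, we have $E(f(a),f(b))$ iff $E(a_1,b_1)$; it behaves like $p_2$ between $a,b$ if, whenever $a_1\neq b_1$ and $a_2\neq b_2$, $E(f(a),f(b))$ iff $E(a_2,b_2)$. A binary injection is of type $\min$ if for all $a,b\in V^2$ with $a_1\neq b_1$, $a_2\neq b_2$: $E(f(a),f(b))$ iff $E(a_1,b_1)\wedge E(a_2,b_2)$; of type $\max$ if for such $a,b$: $N(f(a),f(b))$ iff $N(a_1,b_1)\wedge N(a_2,b_2)$. $f$ generates $g$ if $g$ lies in the smallest set of finitary operations on $V$ containing $f$, all automorphisms of $G$ and all projections, closed under composition and locally closed (containing every $k$-ary $g$ such that for every finite $A\subseteq V^k$ some member agrees with $g$ on $A$). -}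

module Defs where

open import Data.Nat using (ℕ; zero; suc; _<_; _%_; ⌊_/2⌋)
open import Data.Fin using (Fin; zero; suc)
open import Data.Product using (Σ; ∃; _×_; _,_; proj₁; proj₂)
open import Data.Sum using (_⊎_)
open import Data.List using (List)
open import Data.List.Relation.Unary.All using (All)
open import Relation.Nullary using (¬_)
open import Relation.Binary.PropositionalEquality using (_≡_; _≢_)
open import Function.Bundles using (_⇔_)

-- The random (Rado) graph, in its standard concrete presentation on ℕ
-- (Ackermann/Rado BIT construction): for x < y, x and y are adjacent
-- iff the x-th binary digit of y is 1.

V : Set
V = ℕ

bit : ℕ → ℕ → ℕ
bit zero    n = n % 2
bit (suc i) n = bit i ⌊ n /2⌋

Adj : V → V → Set
Adj x y = x < y × bit x y ≡ 1

E : V → V → Set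
E x y = Adj x y ⊎ Adj y x

N : V → V → Set
N x y = x ≢ y × ¬ E x y

V² : Set
V² = V × V

Bin : Set
Bin = V → V → V

app : Bin → V² → V
app f (a₁ , a₂) = f a₁ a₂

BinaryInjection : Bin → Set
BinaryInjection f = ∀ a₁ a₂ b₁ b₂ → f a₁ a₂ ≡ f b₁ b₂ → a₁ ≡ b₁ × a₂ ≡ b₂

PreservesE : Bin → Set
PreservesE f = ∀ a₁ a₂ b₁ b₂ → E a₁ b₁ → E a₂ b₂ → E (f a₁ a₂) (f b₁ b₂)

PreservesN : Bin → Set
PreservesN f = ∀ a₁ a₂ b₁ b₂ → N a₁ b₁ → N a₂ b₂ → N (f a₁ a₂) (f b₁ b₂)

BehavesLikeP₁ : Bin → V² → V² → Set
BehavesLikeP₁ f a b = proj₁ a ≢ proj₁ b → proj₂ a ≢ proj₂ b →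
  (E (app f a) (app f b) ⇔ E (proj₁ a) (proj₁ b))

BehavesLikeP₂ : Bin → V² → V² → Set
BehavesLikeP₂ f a b = proj₁ a ≢ proj₁ b → proj₂ a ≢ proj₂ b →
  (E (app f a) (app f b) ⇔ E (proj₂ a) (proj₂ b))

TypeMin : Bin → Set
TypeMin f = ∀ (a b : V²) → proj₁ a ≢ proj₁ b → proj₂ a ≢ proj₂ b →
  (E (app f a) (app f b) ⇔ (E (proj₁ a) (proj₁ b) × E (proj₂ a) (proj₂ b)))

TypeMax : Bin → Set
TypeMax f = ∀ (a b : V²) → proj₁ a ≢ proj₁ b → proj₂ a ≢ proj₂ b →
  (N (app f a) (app f b) ⇔ (N (proj₁ a) (proj₁ b) × N (proj₂ a) (proj₂ b)))

InU : V² → V² → Set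
InU u v = proj₁ v ≢ proj₁ u × proj₂ v ≢ proj₂ u

record Automorphism : Set where
  field
    σ     : V → V
    σ⁻¹   : V → V
    left  : ∀ x → σ⁻¹ (σ x) ≡ x
    right : ∀ x → σ (σ⁻¹ x) ≡ x
    pres  : ∀ x y → E x y ⇔ E (σ x) (σ y)

Op : ℕ → Set
Op k = (Fin k → V) → V

binOp : Bin → Op 2
binOp f x = f (x zero) (x (suc zero))

data Gen (f : Bin) : {n : ℕ} → Op n → Set where
  base  : Gen f (binOp f)
  aut   : (α : Automorphism) → Gen f {1} (λ x → Automorphism.σ α (x zero))
  proj  : ∀ {n} (i : Fin n) → Gen f {n} (λ x → x i)
  comp  : ∀ {k n} {h : Op k} → Gen f h → (gs : Fin k → Op n) →
          (∀ i → Gen f (gs i)) → Gen f {n} (λ x → h (λ i → gs i x))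
  local : ∀ {n} (g : Op n) →
          (∀ (A : List (Fin n → V)) →
             Σ (Op n) (λ h → Gen f h × All (λ a → h a ≡ g a) A)) →
          Gen f g

Generates : Bin → Bin → Set
Generates f g = Gen f (binOp g)

module Submission where

-- Feed f with automorphic copies of two generated injections φ and ψ,
-- moved so that the images of a point s become u. As f behaves like p₂
-- between u and U and like p₁ inside U, the result ("splicing") behaves
-- like φ between points other than s and like ψ between s and any other
-- point. Copies of f with their exceptional lines moved away behave like
-- p₁, or with swapped arguments like p₂, between two given points, so
-- splicing point by point realizes min, resp. max, on ever larger finite
-- sets. Back and forth in G provides automorphisms making each stage
-- agree with the previous one on the old points, and local closure
-- yields the limit.

open import Data.Bool using (Bool; true; false; if_then_else_)
open import Data.Empty using (⊥-elim)
open import Data.Fin using (Fin; zero; suc)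
open import Data.List using (List; []; _∷_; _++_; map; cartesianProduct; upTo)
open import Data.List.Extrema.Nat using (max; xs≤max)
open import Data.List.Membership.Propositional using (_∈_; _∉_; find; lose)
open import Data.List.Membership.Propositional.Properties
  using (∈-map⁺; ∈-map⁻; ∈-++⁺ˡ; ∈-++⁺ʳ; ∈-cartesianProduct⁺; ∈-upTo⁺)
open import Data.List.Relation.Binary.Subset.Propositional using (_⊆_)
open import Data.List.Relation.Unary.All using (lookup; tabulate)
open import Data.List.Relation.Unary.Any using (Any; here; there; any?)
import Data.List.Relation.Unary.Any as Any
open import Data.Nat
  using (ℕ; zero; suc; _<_; _≤_; _≤′_; ≤′-refl; ≤′-step; _⊔_; _<?_; _≟_; ⌊_/2⌋;
         z≤n; s≤s)
open import Data.Nat.Properties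
  using (<-irrefl; <-asym; <-trans; <-≤-trans; ≤-<-trans; ≤-refl; n≤1+n; m≤n⇒m≤1+n;
         ≤⇒≤′; ≤′⇒≤; m≤m⊔n; m≤n⊔m)
open import Data.Product using (Σ; ∃-syntax; _×_; _,_; proj₁; proj₂; swap; map₂; uncurry)
open import Data.Product.Properties using (≡-dec; ,-injective)
open import Data.List.Membership.DecPropositional (≡-dec _≟_ _≟_) using (_∈?_)
open import Data.Sum using (_⊎_; inj₁; inj₂; [_,_])
open import Function using (id; _∘_)
open import Function.Bundles using (_⇔_; mk⇔; Equivalence)
open import Function.Construct.Symmetry using (⇔-sym)
open import Function.Definitions using (Injective)
open import Function.Properties.Equivalence using (⇔-setoid) renaming (trans to ⇔-trans)
open import Level using (0ℓ)
open import Relation.Nullary using (¬_; Dec; yes; no; does)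
open import Relation.Nullary.Decidable using (_×-dec_; _⊎-dec_)
open import Relation.Unary using (Decidable)
open import Relation.Binary.PropositionalEquality
  using (_≡_; _≢_; refl; sym; trans; cong; cong₂; subst; ≢-sym)
open import Relation.Binary.Reasoning.Setoid (⇔-setoid 0ℓ)

open import Defs

E-sym : ∀ {x y} → E x y → E y x
E-sym (inj₁ p) = inj₂ p
E-sym (inj₂ p) = inj₁ p

E-sym⇔ : ∀ {x y} → E x y ⇔ E y x
E-sym⇔ = mk⇔ E-sym E-sym

E-irrefl : ∀ {x} → ¬ E x x
E-irrefl (inj₁ (x<x , _)) = <-irrefl refl x<x
E-irrefl (inj₂ (x<x , _)) = <-irrefl refl x<x

E? : ∀ x y → Dec (E x y)
E? x y = Adj? x y ⊎-dec Adj? y x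
  where
    Adj? : ∀ x y → Dec (Adj x y)
    Adj? x y = (x <? y) ×-dec (bit x y ≟ 1)

⇔-both-false : ∀ {A B : Set} → ¬ A → ¬ B → A ⇔ B
⇔-both-false ¬a ¬b = mk⇔ (⊥-elim ∘ ¬a) (⊥-elim ∘ ¬b)

bound : List ℕ → ℕ
bound xs = suc (max 0 xs)

<-bound : ∀ {x xs} → x ∈ xs → x < bound xs
<-bound {xs = xs} x∈xs = s≤s (lookup (xs≤max 0 xs) x∈xs)

≢-bound : ∀ {x xs} → x ∈ xs → x ≢ bound xs
≢-bound x∈xs x≡bound = <-irrefl x≡bound (<-bound x∈xs)

double : ℕ → ℕ
double zero    = zero
double (suc n) = suc (suc (double n))

pushBit : Bool → ℕ → ℕ
pushBit true  n = suc (double n)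
pushBit false n = double n

digit : Bool → ℕ
digit b = if b then 1 else 0

bit-zero-pushBit : ∀ b n → bit 0 (pushBit b n) ≡ digit b
bit-zero-pushBit true  zero    = refl
bit-zero-pushBit true  (suc n) = bit-zero-pushBit true n
bit-zero-pushBit false zero    = refl
bit-zero-pushBit false (suc n) = bit-zero-pushBit false n

half-pushBit : ∀ b n → ⌊ pushBit b n /2⌋ ≡ n
half-pushBit true  zero    = refl
half-pushBit true  (suc n) = cong suc (half-pushBit true n)
half-pushBit false zero    = refl
half-pushBit false (suc n) = cong suc (half-pushBit false n)

≤-double : ∀ n → n ≤ double n
≤-double zero    = z≤n
≤-double (suc n) = s≤s (m≤n⇒m≤1+n (≤-double n))

<-double : ∀ {n} → 0 < n → n < double n
<-double {suc n} _ = s≤s (s≤s (≤-double n))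

double≤pushBit : ∀ b n → double n ≤ pushBit b n
double≤pushBit true  n = n≤1+n (double n)
double≤pushBit false n = ≤-refl

fromBits : (ℕ → Bool) → ℕ → ℕ
fromBits b zero    = 1
fromBits b (suc m) = pushBit (b 0) (fromBits (b ∘ suc) m)

bit-fromBits : ∀ b {m j} → j < m → bit j (fromBits b m) ≡ digit (b j)
bit-fromBits b {suc m} {zero}  _         = bit-zero-pushBit (b 0) _
bit-fromBits b {suc m} {suc j} (s≤s j<m) =
  trans (cong (bit j) (half-pushBit (b 0) _)) (bit-fromBits (b ∘ suc) j<m)

<-fromBits : ∀ b m → m < fromBits b m
<-fromBits b zero    = s≤s z≤n
<-fromBits b (suc m) =
  <-≤-trans (≤-<-trans m<X (<-double (≤-<-trans z≤n m<X))) (double≤pushBit (b 0) _)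
  where m<X = <-fromBits (b ∘ suc) m

digit-does : ∀ {P : Set} (P? : Dec P) → digit (does P?) ≡ 1 ⇔ P
digit-does (yes p) = mk⇔ (λ _ → p) (λ _ → refl)
digit-does (no ¬p) = mk⇔ (λ ()) (⊥-elim ∘ ¬p)

E-above : ∀ {x z} → x < z → E z x ⇔ bit x z ≡ 1
E-above x<z = mk⇔ (λ { (inj₁ (z<x , _)) → ⊥-elim (<-asym x<z z<x) ; (inj₂ (_ , b)) → b })
                  (λ b → inj₂ (x<z , b))

extension : ∀ B {P : V → Set} → Decidable P →
  ∃[ z ] B < z × (∀ {x} → x < B → E z x ⇔ P x)
extension B {P} P? = z , B<z , λ {x} x<B →
  begin
    E z x                   ≈⟨ E-above (<-trans x<B B<z) ⟩
    bit x z ≡ 1             ≡⟨ cong (_≡ 1) (bit-fromBits _ x<B) ⟩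
    digit (does (P? x)) ≡ 1 ≈⟨ digit-does (P? x) ⟩
    P x                     ∎
  where
    z = fromBits (λ j → does (P? j)) B
    B<z = <-fromBits _ B

-- Back and forth

⊆-chain : ∀ {A : Set} (X : ℕ → List A) → (∀ n → X n ⊆ X (suc n)) →
  ∀ {m n} → m ≤ n → X m ⊆ X n
⊆-chain X X-⊆-suc = go ∘ ≤⇒≤′
  where
    go : ∀ {m n} → m ≤′ n → X m ⊆ X n
    go ≤′-refl            = id
    go (≤′-step {n} m≤′n) = X-⊆-suc n ∘ go m≤′n

Compatible : V × V → V × V → Set
Compatible (a , v) (b , w) = (a ≡ b ⇔ v ≡ w) × (E a b ⇔ E v w)

Compatible-refl : ∀ p → Compatible p p
Compatible-refl _ = mk⇔ (λ _ → refl) (λ _ → refl) , ⇔-both-false E-irrefl E-irrefl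

Compatible-sym : ∀ {p q} → Compatible p q → Compatible q p
Compatible-sym (eq , edge) =
  mk⇔ (sym ∘ Equivalence.to eq ∘ sym) (sym ∘ Equivalence.from eq ∘ sym) ,
  mk⇔ (E-sym ∘ Equivalence.to edge ∘ E-sym) (E-sym ∘ Equivalence.from edge ∘ E-sym)

Compatible-swap : ∀ {p q} → Compatible p q → Compatible (swap p) (swap q)
Compatible-swap (eq , edge) = ⇔-sym eq , ⇔-sym edge

IsPartialIso : List (V × V) → Set
IsPartialIso L = ∀ {p q} → p ∈ L → q ∈ L → Compatible p q

record PartialIso : Set where
  field
    pairs        : List (V × V)
    isPartialIso : IsPartialIso pairs

open PartialIso

_∈dom_ : V → PartialIso → Set
c ∈dom P = ∃[ v ] (c , v) ∈ pairs P

_∈ran_ : V → PartialIso → Set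
v ∈ran P = ∃[ c ] (c , v) ∈ pairs P

inverse : PartialIso → PartialIso
inverse P = record
  { pairs        = map swap (pairs P)
  ; isPartialIso = λ p∈ q∈ → Compatible-swap (isPartialIso P (swap∈ p∈) (swap∈ q∈))
  }
  where
    swap∈ : ∀ {p} → p ∈ map swap (pairs P) → swap p ∈ pairs P
    swap∈ p∈ with _ , p∈P , refl ← ∈-map⁻ swap p∈ = p∈P

-- A new point c is sent to a vertex, given by the extension property,
-- whose neighbours in the range are the images of the neighbours of c.
forth : ∀ c (P : PartialIso) → Σ PartialIso λ Q → pairs P ⊆ pairs Q × c ∈dom Q
forth c P with any? (λ p → proj₁ p ≟ c) (pairs P)
... | yes c∈dom with (_ , v) , cv∈ , refl ← find c∈dom = P , id , v , cv∈
... | no c∉dom = Q , there , z , here refl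
  where
    L = pairs P
    ImageOfNeighbour : V → Set
    ImageOfNeighbour y = Any (λ p → proj₂ p ≡ y × E c (proj₁ p)) L
    new = extension (bound (map proj₂ L))
                    (λ y → any? (λ p → (proj₂ p ≟ y) ×-dec E? c (proj₁ p)) L)
    z = proj₁ new
    bound<z = proj₁ (proj₂ new)
    fresh : ∀ {b w} → (b , w) ∈ L → Compatible (c , z) (b , w)
    fresh {b} {w} bw∈ =
      ⇔-both-false (λ { refl → c∉dom (lose bw∈ refl) })
                   (λ { refl → <-irrefl refl (<-trans w<bound bound<z) }) ,
      ⇔-sym (begin
        E z w              ≈⟨ proj₂ (proj₂ new) w<bound ⟩
        ImageOfNeighbour w ≈⟨ mk⇔ preimage (λ e → lose bw∈ (refl , e)) ⟩
        E c b              ∎)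
      where
        w<bound = <-bound (∈-map⁺ proj₂ bw∈)
        preimage : ImageOfNeighbour w → E c b
        preimage im with _ , bw′∈ , refl , e ← find im
          with refl ← Equivalence.from (proj₁ (isPartialIso P bw′∈ bw∈)) refl = e
    compatible : IsPartialIso ((c , z) ∷ L)
    compatible (here refl) (here refl) = Compatible-refl (c , z)
    compatible (here refl) (there q∈)  = fresh q∈
    compatible (there p∈)  (here refl) = Compatible-sym (fresh p∈)
    compatible (there p∈)  (there q∈)  = isPartialIso P p∈ q∈
    Q = record { pairs = (c , z) ∷ L ; isPartialIso = compatible }

back : ∀ v (P : PartialIso) → Σ PartialIso λ Q → pairs P ⊆ pairs Q × v ∈ran Q
back v P with Q , P⁻¹⊆Q , c , vc∈Q ← forth v (inverse P) =
  inverse Q , (λ p∈P → ∈-map⁺ swap (P⁻¹⊆Q (∈-map⁺ swap p∈P))) , c , ∈-map⁺ swap vc∈Q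

record Extension (P : PartialIso) (x : V) : Set where
  field
    extended   : PartialIso
    ⊆-extended : pairs P ⊆ pairs extended
    x∈dom      : x ∈dom extended
    x∈ran      : x ∈ran extended

open Extension

backAndForth : ∀ x P → Extension P x
backAndForth x P
  with Q , P⊆Q , x∈domQ ← forth x P
  with R , Q⊆R , x∈ranR ← back x Q =
  record
    { extended   = R
    ; ⊆-extended = Q⊆R ∘ P⊆Q
    ; x∈dom      = map₂ Q⊆R x∈domQ
    ; x∈ran      = x∈ranR
    }

module BackAndForth (P₀ : PartialIso) where

  stage : ℕ → PartialIso
  stage zero    = P₀
  stage (suc k) = extended (backAndForth k (stage k))

  compatible : ∀ m n {p q} → p ∈ pairs (stage m) → q ∈ pairs (stage n) → Compatible p q
  compatible m n p∈ q∈ =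
    isPartialIso (stage (m ⊔ n)) (stage-mono (m≤m⊔n m n) p∈) (stage-mono (m≤n⊔m m n) q∈)
    where stage-mono = ⊆-chain (pairs ∘ stage) (λ k → ⊆-extended (backAndForth k (stage k)))

  σ σ⁻¹ : V → V
  σ   x = proj₁ (x∈dom (backAndForth x (stage x)))
  σ⁻¹ y = proj₁ (x∈ran (backAndForth y (stage y)))

  σ∈ : ∀ x → (x , σ x) ∈ pairs (stage (suc x))
  σ∈ x = proj₂ (x∈dom (backAndForth x (stage x)))

  σ⁻¹∈ : ∀ y → (σ⁻¹ y , y) ∈ pairs (stage (suc y))
  σ⁻¹∈ y = proj₂ (x∈ran (backAndForth y (stage y)))

  automorphism : Automorphism
  automorphism = record
    { σ     = σ
    ; σ⁻¹   = σ⁻¹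
    ; left  = λ x →
        Equivalence.from (proj₁ (compatible (suc (σ x)) (suc x) (σ⁻¹∈ (σ x)) (σ∈ x))) refl
    ; right = λ y →
        Equivalence.to (proj₁ (compatible (suc (σ⁻¹ y)) (suc y) (σ∈ (σ⁻¹ y)) (σ⁻¹∈ y))) refl
    ; pres  = λ x y → proj₂ (compatible (suc x) (suc y) (σ∈ x) (σ∈ y))
    }

  extends : ∀ {a v} → (a , v) ∈ pairs P₀ → σ a ≡ v
  extends {a} av∈ = Equivalence.to (proj₁ (compatible (suc a) 0 (σ∈ a) av∈)) refl

opaque
  extendToAutomorphism : (P : PartialIso) →
    Σ Automorphism λ α → ∀ {a v} → (a , v) ∈ pairs P → Automorphism.σ α a ≡ v
  extendToAutomorphism P = automorphism , extends
    where open BackAndForth P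

vertexTransitive : ∀ x y → Σ Automorphism λ α → Automorphism.σ α x ≡ y
vertexTransitive x y = proj₁ extended′ , proj₂ extended′ (here refl)
  where
    extended′ = extendToAutomorphism (record
      { pairs        = (x , y) ∷ []
      ; isPartialIso = λ { (here refl) (here refl) → Compatible-refl (x , y) }
      })

moveTo : V → V → Automorphism
moveTo x y = proj₁ (vertexTransitive x y)

moveTo-moves : ∀ x y → Automorphism.σ (moveTo x y) x ≡ y
moveTo-moves x y = proj₂ (vertexTransitive x y)

σ-injective : ∀ (α : Automorphism) → Injective _≡_ _≡_ (Automorphism.σ α)
σ-injective α {x} {y} σx≡σy = trans (sym (left x)) (trans (cong σ⁻¹ σx≡σy) (left y))
  where open Automorphism α

_≟²_ : (a b : V²) → Dec (a ≡ b)
_≟²_ = ≡-dec _≟_ _≟_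

align : ∀ (A : List V²) (g h : Bin) → Injective _≡_ _≡_ (app g) → Injective _≡_ _≡_ (app h) →
  (∀ {a b} → a ∈ A → b ∈ A → a ≢ b → E (app g a) (app g b) ⇔ E (app h a) (app h b)) →
  Σ Automorphism λ α → ∀ {a} → a ∈ A → Automorphism.σ α (app g a) ≡ app h a
align A g h g-injective h-injective same-edges =
  proj₁ extended′ , λ a∈ → proj₂ extended′ (∈-map⁺ values a∈)
  where
    values : V² → V × V
    values a = app g a , app h a
    compatible : IsPartialIso (map values A)
    compatible p∈ q∈
      with a , a∈ , refl ← ∈-map⁻ values p∈
         | b , b∈ , refl ← ∈-map⁻ values q∈ =
      mk⇔ (cong (app h) ∘ g-injective) (cong (app g) ∘ h-injective) , edges
      where
        edges : E (app g a) (app g b) ⇔ E (app h a) (app h b)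
        edges with a ≟² b
        ... | yes refl = ⇔-both-false E-irrefl E-irrefl
        ... | no a≢b   = same-edges a∈ b∈ a≢b
    extended′ = extendToAutomorphism (record { pairs = map values A ; isPartialIso = compatible })

Apart : V² → V² → Set
Apart a b = proj₁ a ≢ proj₁ b × proj₂ a ≢ proj₂ b

Apart-sym : ∀ {a b} → Apart a b → Apart b a
Apart-sym (a₁≢b₁ , a₂≢b₂) = ≢-sym a₁≢b₁ , ≢-sym a₂≢b₂

Apart-swap : ∀ {a b} → Apart a b → Apart (swap a) (swap b)
Apart-swap (a₁≢b₁ , a₂≢b₂) = a₂≢b₂ , a₁≢b₁

Apart⇒≢ : ∀ {a b} → Apart a b → a ≢ b
Apart⇒≢ (a₁≢b₁ , _) refl = a₁≢b₁ refl

coordinates : V² → V² → List V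
coordinates (a₁ , a₂) (c₁ , c₂) = a₁ ∷ a₂ ∷ c₁ ∷ c₂ ∷ []

offPoint : V² → V² → V
offPoint a c = bound (coordinates a c)

offPoint-apart : ∀ a c → let W = offPoint a c in Apart a (W , W) × Apart c (W , W)
offPoint-apart a c =
  (avoid (here refl) , avoid (there (here refl))) ,
  (avoid (there (there (here refl))) , avoid (there (there (there (here refl)))))
  where
    avoid : ∀ {x} → x ∈ coordinates a c → x ≢ offPoint a c
    avoid = ≢-bound

⟪_,_⟫ : Bin → Bin → V² → V²
⟪ φ , ψ ⟫ x = app φ x , app ψ x

p₁ p₂ : Bin
p₁ x y = x
p₂ x y = y

module _ {f : Bin} where

  generates-p₁ : Generates f p₁
  generates-p₁ = proj zero

  generates-p₂ : Generates f p₂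
  generates-p₂ = proj (suc zero)

  generates-σ∘ : (α : Automorphism) {h : Bin} → Generates f h →
    Generates f (λ x y → Automorphism.σ α (h x y))
  generates-σ∘ α {h} gen-h = comp (aut α) (λ _ → binOp h) (λ _ → gen-h)

  generates-f∘ : {h₁ h₂ : Bin} → Generates f h₁ → Generates f h₂ →
    Generates f (λ x y → f (h₁ x y) (h₂ x y))
  generates-f∘ {h₁} {h₂} gen₁ gen₂ =
    comp base (λ { zero → binOp h₁ ; (suc zero) → binOp h₂ })
              (λ { zero → gen₁ ; (suc zero) → gen₂ })

record Behaviour : Set₁ where
  field
    Rel             : V² → V² → Set
    Rel-sym         : ∀ {a b} → Rel a b → Rel b a
    like-projection : ∀ a b →
      (Rel a b ⇔ E (proj₁ a) (proj₁ b)) ⊎ (Rel a b ⇔ E (proj₂ a) (proj₂ b))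

minBehaviour : Behaviour
minBehaviour = record
  { Rel             = λ a b → E (proj₁ a) (proj₁ b) × E (proj₂ a) (proj₂ b)
  ; Rel-sym         = λ (e₁ , e₂) → E-sym e₁ , E-sym e₂
  ; like-projection = λ a b → choose (E? (proj₁ a) (proj₁ b))
  }
  where
    choose : ∀ {A B : Set} → Dec A → ((A × B) ⇔ A) ⊎ ((A × B) ⇔ B)
    choose (yes a) = inj₂ (mk⇔ proj₂ (a ,_))
    choose (no ¬a) = inj₁ (⇔-both-false (¬a ∘ proj₁) ¬a)

maxBehaviour : Behaviour
maxBehaviour = record
  { Rel             = λ a b → E (proj₁ a) (proj₁ b) ⊎ E (proj₂ a) (proj₂ b)
  ; Rel-sym         = [ inj₁ ∘ E-sym , inj₂ ∘ E-sym ]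
  ; like-projection = λ a b → choose (E? (proj₁ a) (proj₁ b))
  }
  where
    choose : ∀ {A B : Set} → Dec A → ((A ⊎ B) ⇔ A) ⊎ ((A ⊎ B) ⇔ B)
    choose (yes a) = inj₁ (mk⇔ (λ _ → a) inj₁)
    choose (no ¬a) = inj₂ (mk⇔ [ ⊥-elim ∘ ¬a , id ] inj₂)

Realizes : Behaviour → List V² → Bin → Set
Realizes B A h =
  ∀ {a b} → a ∈ A → b ∈ A → Apart a b → E (app h a) (app h b) ⇔ Behaviour.Rel B a b

RealizesEverywhere : Behaviour → Bin → Set
RealizesEverywhere B h = ∀ a b → Apart a b → E (app h a) (app h b) ⇔ Behaviour.Rel B a b

module Construction
  (u : V²) (f : Bin) (f-injective : BinaryInjection f)
  (f-like-p₁ : ∀ v w → InU u v → InU u w → BehavesLikeP₁ f v w)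
  (f-like-p₂ : ∀ v → InU u v → BehavesLikeP₂ f u v)
  where

  -- Splicing

  module _ (s : V²) (φ ψ : Bin) where

    private
      α = moveTo (app φ s) (proj₁ u)
      β = moveTo (app ψ s) (proj₂ u)
      open Automorphism

      image : V² → V²
      image x = σ α (app φ x) , σ β (app ψ x)

      image-s : image s ≡ u
      image-s = cong₂ _,_ (moveTo-moves _ _) (moveTo-moves _ _)

      image-apart : ∀ {x y} → Apart (⟪ φ , ψ ⟫ x) (⟪ φ , ψ ⟫ y) → Apart (image x) (image y)
      image-apart (φ≢ , ψ≢) = φ≢ ∘ σ-injective α , ψ≢ ∘ σ-injective β

      image-in-U : ∀ {x} → Apart (⟪ φ , ψ ⟫ x) (⟪ φ , ψ ⟫ s) → InU u (image x)
      image-in-U {x} x-apart-s = subst (Apart (image x)) image-s (image-apart x-apart-s)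

    splice : Bin
    splice x y = app f (image (x , y))

    splice-generates : Generates f φ → Generates f ψ → Generates f splice
    splice-generates gen-φ gen-ψ =
      generates-f∘ {h₁ = λ x y → σ α (φ x y)} {h₂ = λ x y → σ β (ψ x y)}
        (generates-σ∘ α {φ} gen-φ) (generates-σ∘ β {ψ} gen-ψ)

    splice-injective : Injective _≡_ _≡_ ⟪ φ , ψ ⟫ → Injective _≡_ _≡_ (app splice)
    splice-injective ⟪φ,ψ⟫-injective e with e₁ , e₂ ← f-injective _ _ _ _ e =
      ⟪φ,ψ⟫-injective (cong₂ _,_ (σ-injective α e₁) (σ-injective β e₂))

    splice-off : ∀ {x y} →
      Apart (⟪ φ , ψ ⟫ x) (⟪ φ , ψ ⟫ s) → Apart (⟪ φ , ψ ⟫ y) (⟪ φ , ψ ⟫ s) →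
      Apart (⟪ φ , ψ ⟫ x) (⟪ φ , ψ ⟫ y) →
      E (app splice x) (app splice y) ⇔ E (app φ x) (app φ y)
    splice-off {x} {y} x-apart-s y-apart-s x-apart-y =
      begin
        E (app f (image x)) (app f (image y)) ≈⟨ like-p₁ ⟩
        E (σ α (app φ x)) (σ α (app φ y))     ≈⟨ pres α _ _ ⟨
        E (app φ x) (app φ y)                 ∎
      where
        like-p₁ = uncurry (f-like-p₁ _ _ (image-in-U x-apart-s) (image-in-U y-apart-s))
                          (image-apart x-apart-y)

    splice-at : ∀ {y} → Apart (⟪ φ , ψ ⟫ y) (⟪ φ , ψ ⟫ s) →
      E (app splice s) (app splice y) ⇔ E (app ψ s) (app ψ y)
    splice-at {y} y-apart-s =
      begin
        E (app f (image s)) (app f (image y)) ≡⟨ cong (λ v → E (app f v) (app f (image y))) image-s ⟩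
        E (app f u) (app f (image y))         ≈⟨ uncurry (f-like-p₂ _ y-in-U) (Apart-sym y-in-U) ⟩
        E (proj₂ u) (σ β (app ψ y))           ≡⟨ cong (λ v → E v (σ β (app ψ y))) (moveTo-moves _ _) ⟨
        E (σ β (app ψ s)) (σ β (app ψ y))     ≈⟨ pres β _ _ ⟨
        E (app ψ s) (app ψ y)                 ∎
      where y-in-U = image-in-U y-apart-s

  record GeneratedInjection : Set where
    field
      op        : Bin
      generated : Generates f op
      injective : Injective _≡_ _≡_ (app op)

  open GeneratedInjection

  f-generated : GeneratedInjection
  f-generated = record
    { op        = f
    ; generated = base
    ; injective = uncurry (cong₂ _,_) ∘ f-injective _ _ _ _
    }

  _∘σ_ : Automorphism → GeneratedInjection → GeneratedInjection
  α ∘σ h = record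
    { op        = λ x y → Automorphism.σ α (op h x y)
    ; generated = generates-σ∘ α {op h} (generated h)
    ; injective = injective h ∘ σ-injective α
    }

  module _ (s : V²) (φ ψ : GeneratedInjection) where

    private
      images-apart : ∀ {x y} → x ≢ y → Apart (⟪ op φ , op ψ ⟫ x) (⟪ op φ , op ψ ⟫ y)
      images-apart x≢y = x≢y ∘ injective φ , x≢y ∘ injective ψ

    spliceInj : GeneratedInjection
    spliceInj = record
      { op        = splice s (op φ) (op ψ)
      ; generated = splice-generates s (op φ) (op ψ) (generated φ) (generated ψ)
      ; injective = splice-injective s (op φ) (op ψ) (injective φ ∘ cong proj₁)
      }

    spliceInj-off : ∀ {x y} → x ≢ s → y ≢ s → x ≢ y →
      E (app (op spliceInj) x) (app (op spliceInj) y) ⇔ E (app (op φ) x) (app (op φ) y)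
    spliceInj-off x≢s y≢s x≢y =
      splice-off s (op φ) (op ψ) (images-apart x≢s) (images-apart y≢s) (images-apart x≢y)

    spliceInj-at : ∀ {y} → y ≢ s →
      E (app (op spliceInj) s) (app (op spliceInj) y) ⇔ E (app (op ψ) s) (app (op ψ) y)
    spliceInj-at y≢s = splice-at s (op φ) (op ψ) (images-apart y≢s)

  -- Splicing the projections at (W , W) moves the exceptional lines of f
  -- to x = W and y = W.
  module _ (W : V) where

    p₁-off : GeneratedInjection
    p₁-off = record
      { op        = splice (W , W) p₁ p₂
      ; generated = splice-generates (W , W) p₁ p₂ generates-p₁ generates-p₂
      ; injective = splice-injective (W , W) p₁ p₂ id
      }

    p₂-off : GeneratedInjection
    p₂-off = record
      { op        = splice (W , W) p₂ p₁
      ; generated = splice-generates (W , W) p₂ p₁ generates-p₂ generates-p₁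
      ; injective = splice-injective (W , W) p₂ p₁ (cong swap)
      }

  -- Realizing a behaviour

  module Realization (B : Behaviour) where
    open Behaviour B

    Rel-sym⇔ : ∀ {a b} → Rel a b ⇔ Rel b a
    Rel-sym⇔ = mk⇔ Rel-sym Rel-sym

    realizerFor : ∀ a c → Σ GeneratedInjection λ ψ →
      Apart a c → E (app (op ψ) a) (app (op ψ) c) ⇔ Rel a c
    realizerFor a c = realizer (like-projection a c)
      where
        W = offPoint a c
        a-off = proj₁ (offPoint-apart a c)
        c-off = proj₂ (offPoint-apart a c)
        realizer : (Rel a c ⇔ E (proj₁ a) (proj₁ c)) ⊎ (Rel a c ⇔ E (proj₂ a) (proj₂ c)) →
          Σ GeneratedInjection λ ψ → Apart a c → E (app (op ψ) a) (app (op ψ) c) ⇔ Rel a c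
        realizer (inj₁ Rel⇔E₁) = p₁-off W , λ a-apart-c →
          ⇔-trans (splice-off (W , W) p₁ p₂ a-off c-off a-apart-c) (⇔-sym Rel⇔E₁)
        realizer (inj₂ Rel⇔E₂) = p₂-off W , λ a-apart-c →
          ⇔-trans (splice-off (W , W) p₂ p₁ (Apart-swap a-off) (Apart-swap c-off)
                                                 (Apart-swap a-apart-c))
                  (⇔-sym Rel⇔E₂)

    star : V² → List V² → GeneratedInjection
    star c []      = f-generated
    star c (a ∷ A) = spliceInj a (star c A) (proj₁ (realizerFor a c))

    star-realizes : ∀ {c} A → c ∉ A → ∀ {a} → a ∈ A → Apart c a →
      E (app (op (star c A)) c) (app (op (star c A)) a) ⇔ Rel c a
    star-realizes {c} (a ∷ A) c∉ {a′} a′∈ c-apart-a′ with a′ ≟² a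
    ... | yes refl =
      begin
        E (app M c) (app M a) ≈⟨ E-sym⇔ ⟩
        E (app M a) (app M c) ≈⟨ spliceInj-at a (star c A) ψ (c∉ ∘ here) ⟩
        E (app (op ψ) a) (app (op ψ) c) ≈⟨ ψ-realizes (Apart-sym c-apart-a′) ⟩
        Rel a c               ≈⟨ Rel-sym⇔ ⟩
        Rel c a               ∎
      where
        M = op (star c (a ∷ A))
        ψ = proj₁ (realizerFor a c)
        ψ-realizes = proj₂ (realizerFor a c)
    ... | no a′≢a =
      ⇔-trans (spliceInj-off a (star c A) (proj₁ (realizerFor a c))
                             (c∉ ∘ here) a′≢a (Apart⇒≢ c-apart-a′))
              (star-realizes A (c∉ ∘ there) (Any.tail a′≢a a′∈) c-apart-a′)

    record Stage (A : List V²) : Set where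
      field
        injection : GeneratedInjection
        realizes  : Realizes B A (op injection)

    open Stage

    Agree : List V² → Bin → Bin → Set
    Agree A g h = ∀ {a} → a ∈ A → app g a ≡ app h a

    σ∘-realizes : ∀ {A} α (h : GeneratedInjection) →
      Realizes B A (op h) → Realizes B A (op (α ∘σ h))
    σ∘-realizes α h h-realizes a∈ b∈ a-apart-b =
      ⇔-trans (⇔-sym (Automorphism.pres α _ _)) (h-realizes a∈ b∈ a-apart-b)

    splice-star-realizes : ∀ {c A} (h : GeneratedInjection) → c ∉ A → Realizes B A (op h) →
      Realizes B (c ∷ A) (op (spliceInj c h (star c A)))
    splice-star-realizes {c} {A} h c∉A h-realizes = realizes′
      where
        M = star c A
        h′ = op (spliceInj c h M)
        ≢c : ∀ {a} → a ∈ A → a ≢ c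
        ≢c a∈ refl = c∉A a∈
        from-c : ∀ {b} → b ∈ A → Apart c b → E (app h′ c) (app h′ b) ⇔ Rel c b
        from-c b∈ c-apart-b =
          ⇔-trans (spliceInj-at c h M (≢c b∈)) (star-realizes A c∉A b∈ c-apart-b)
        realizes′ : Realizes B (c ∷ A) h′
        realizes′ (here refl) (here refl) c-apart-c = ⊥-elim (Apart⇒≢ c-apart-c refl)
        realizes′ (here refl) (there b∈)  c-apart-b = from-c b∈ c-apart-b
        realizes′ (there a∈)  (here refl) a-apart-c =
          ⇔-trans E-sym⇔ (⇔-trans (from-c a∈ (Apart-sym a-apart-c)) Rel-sym⇔)
        realizes′ (there a∈)  (there b∈)  a-apart-b =
          ⇔-trans (spliceInj-off c h M (≢c a∈) (≢c b∈) (Apart⇒≢ a-apart-b))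
                  (h-realizes a∈ b∈ a-apart-b)

    extendStage : ∀ c {A} (S : Stage A) →
      Σ (Stage (c ∷ A)) λ S′ → Agree A (op (injection S′)) (op (injection S))
    extendStage c {A} S with c ∈? A
    ... | yes c∈A =
      record { injection = injection S ; realizes = λ a∈ b∈ → realizes S (drop a∈) (drop b∈) } ,
      λ _ → refl
      where
        drop : ∀ {a} → a ∈ c ∷ A → a ∈ A
        drop (here refl) = c∈A
        drop (there a∈)  = a∈
    ... | no c∉A =
      record { injection = α ∘σ h′
             ; realizes  = σ∘-realizes α h′ (splice-star-realizes h c∉A (realizes S)) } ,
      proj₂ aligned
      where
        h = injection S
        h′ = spliceInj c h (star c A)
        aligned = align A (op h′) (op h) (injective h′) (injective h) λ a∈ b∈ →
          spliceInj-off c h (star c A) (λ { refl → c∉A a∈ }) (λ { refl → c∉A b∈ })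
        α = proj₁ aligned

    extendStages : ∀ C {A} (S : Stage A) →
      Σ (Stage (C ++ A)) λ S′ → Agree A (op (injection S′)) (op (injection S))
    extendStages []      S = S , λ _ → refl
    extendStages (c ∷ C) S
      with S′ , agree′ ← extendStages C S
      with S″ , agree″ ← extendStage c S′ =
      S″ , λ a∈ → trans (agree″ (∈-++⁺ʳ C a∈)) (agree′ a∈)

    square : ℕ → List V²
    square n = cartesianProduct (upTo n) (upTo n)

    covered : ℕ → List V²
    covered zero    = []
    covered (suc n) = square n ++ covered n

    covered-mono : ∀ {m n} → m ≤ n → covered m ⊆ covered n
    covered-mono = ⊆-chain covered (λ n → ∈-++⁺ʳ (square n))

    depth : V² → ℕ
    depth (a₁ , a₂) = suc (suc (a₁ ⊔ a₂))

    ∈-covered-depth : ∀ a → a ∈ covered (depth a)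
    ∈-covered-depth (a₁ , a₂) =
      ∈-++⁺ˡ (∈-cartesianProduct⁺ (∈-upTo⁺ (s≤s (m≤m⊔n a₁ a₂)))
                                  (∈-upTo⁺ (s≤s (m≤n⊔m a₁ a₂))))

    stage : ∀ n → Stage (covered n)
    stage zero    = record { injection = f-generated ; realizes = λ () }
    stage (suc n) = proj₁ (extendStages (square n) (stage n))

    approx : ℕ → Bin
    approx n = op (injection (stage n))

    approx-agree : ∀ {m n} → m ≤ n → Agree (covered m) (approx n) (approx m)
    approx-agree = go ∘ ≤⇒≤′
      where
        go : ∀ {m n} → m ≤′ n → Agree (covered m) (approx n) (approx m)
        go ≤′-refl            _  = refl
        go (≤′-step {n} m≤′n) a∈ =
          trans (proj₂ (extendStages (square n) (stage n)) (covered-mono (≤′⇒≤ m≤′n) a∈))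
                (go m≤′n a∈)

    limit : Bin
    limit x y = approx (depth (x , y)) x y

    limit-agrees : ∀ {n} a → depth a ≤ n → app limit a ≡ app (approx n) a
    limit-agrees a d≤n = sym (approx-agree d≤n (∈-covered-depth a))

    limit-generated : Generates f limit
    limit-generated = local (binOp limit) λ xs →
      let n = max 0 (map (depth ∘ point) xs) in
      binOp (approx n) , generated (injection (stage n)) ,
      tabulate λ {x} x∈ →
        sym (limit-agrees (point x) (lookup (xs≤max 0 _) (∈-map⁺ (depth ∘ point) x∈)))
      where
        point : (Fin 2 → V) → V²
        point x = x zero , x (suc zero)

    module _ (a b : V²) where
      private
        n = depth a ⊔ depth b
        a-deep = m≤m⊔n (depth a) (depth b)
        b-deep = m≤n⊔m (depth a) (depth b)

      limit-injective : app limit a ≡ app limit b → a ≡ b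
      limit-injective e =
        injective (injection (stage n))
          (trans (sym (limit-agrees a a-deep)) (trans e (limit-agrees b b-deep)))

      limit-realizes : Apart a b → E (app limit a) (app limit b) ⇔ Rel a b
      limit-realizes a-apart-b =
        begin
          E (app limit a) (app limit b)           ≡⟨ cong₂ E (limit-agrees a a-deep) (limit-agrees b b-deep) ⟩
          E (app (approx n) a) (app (approx n) b) ≈⟨ realizes (stage n) (in-covered a a-deep)
                                                                         (in-covered b b-deep) a-apart-b ⟩
          Rel a b                                 ∎
        where
          in-covered : ∀ x → depth x ≤ n → x ∈ covered n
          in-covered x d≤n = covered-mono d≤n (∈-covered-depth x)

    realization : Σ GeneratedInjection (RealizesEverywhere B ∘ op)
    realization = record { op = limit ; generated = limit-generated ; injective = limit-injective _ _ }
                , limit-realizes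

injective⇒BinaryInjection : ∀ {g} → Injective _≡_ _≡_ (app g) → BinaryInjection g
injective⇒BinaryInjection g-injective _ _ _ _ = ,-injective ∘ g-injective

realizes-min⇒TypeMin : ∀ {g} → RealizesEverywhere minBehaviour g → TypeMin g
realizes-min⇒TypeMin realizes a b a₁≢b₁ a₂≢b₂ = realizes a b (a₁≢b₁ , a₂≢b₂)

realizes-max⇒TypeMax : ∀ {g} → Injective _≡_ _≡_ (app g) →
  RealizesEverywhere maxBehaviour g → TypeMax g
realizes-max⇒TypeMax {g} g-injective realizes a b a₁≢b₁ a₂≢b₂ = mk⇔ to from
  where
    edges = realizes a b (a₁≢b₁ , a₂≢b₂)
    to : N (app g a) (app g b) → N (proj₁ a) (proj₁ b) × N (proj₂ a) (proj₂ b)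
    to (_ , ¬E) =
      (a₁≢b₁ , ¬E ∘ Equivalence.from edges ∘ inj₁) , (a₂≢b₂ , ¬E ∘ Equivalence.from edges ∘ inj₂)
    from : N (proj₁ a) (proj₁ b) × N (proj₂ a) (proj₂ b) → N (app g a) (app g b)
    from ((_ , ¬E₁) , (_ , ¬E₂)) =
      a₁≢b₁ ∘ cong proj₁ ∘ g-injective , [ ¬E₁ , ¬E₂ ] ∘ Equivalence.to edges

-- The construction does not use that f preserves E and N.
mainTheorem13 : (u : V²) (f : Bin) →
    BinaryInjection f → PreservesE f → PreservesN f →
    (∀ v w → InU u v → InU u w → BehavesLikeP₁ f v w) →
    (∀ v → InU u v → BehavesLikeP₂ f u v) →
    Σ Bin (λ g → Generates f g × BinaryInjection g × TypeMin g) ×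
    Σ Bin (λ g → Generates f g × BinaryInjection g × TypeMax g)
mainTheorem13 u f f-injective _ _ like-p₁ like-p₂ =
  let open Construction u f f-injective like-p₁ like-p₂
      open GeneratedInjection
      (gmin , min-realizes) = Realization.realization minBehaviour
      (gmax , max-realizes) = Realization.realization maxBehaviour
  in (op gmin , generated gmin , injective⇒BinaryInjection (injective gmin) ,
      realizes-min⇒TypeMin min-realizes) ,
     (op gmax , generated gmax , injective⇒BinaryInjection (injective gmax) ,
      realizes-max⇒TypeMax (injective gmax) max-realizes)
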